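{- Let $P$ be a poset and $v$ an assignment of variables to elements of $P$. Then for all $m,n\in\omega$, $P,v\models\phi_{mn}(\vec{x}_m,y)$ if and only if $\exists$ has an $n$-strategy for the game on $P$ with starting position $(\{v(x_1),\dots,v(x_m)\},\{v(y)\})$.
   Context: The game on $P$ with starting position $(U_0,V)$ ($U_0,V\subseteq P$) is played by $\forall$ and $\exists$ in rounds $0,1,2,\dots$; a set $U$ starts as $U_0$. $\forall$ wins in round $n$ if $U\cap V\neq\emptyset$ at the beginning of round $n$. In each round $\forall$ makes one of the moves: (1) pick $b\in P$ with $b\geq a$ for some $a\in U$; $\exists$ must add $b$ to $U$. (2) pick $a,b\in U$ such that $a\wedge b$ exists in $P$; $\exists$ must add $a\wedge b$ to $U$. (3) pick $a,b\in P$ such that $a\vee b$ exists in $P$ and lies in $U$; $\exists$ must choose one of $a,b$ and add it to $U$. $\exists$ has an $n$-strategy if she can guarantee that $\forall$ does not win in any round $\leq n$, however $\forall$ plays. Formulas (signature $\{\leq\}$): $J(x,y,z)$ holds exactly when $z$ is the join of $x,y$; $M(x,y,z)$ exactly when $z$ is the meet of $x,y$. For $\vec{x}_m=(x_1,\dots,x_m)$, $C_m(\vec{x}_m,y)$ is $\bigvee_{i=1}^m y=x_i$ ($C_0$ false) and $D_m=\neg C_m$. Recursively: $\phi_{m0}(\vec{x}_m,y)=D_m(\vec{x}_m,y)$ and $\phi_{m(n+1)}(\vec{x}_m,y)=\forall a\forall b\Big(\big(\exists c(C_m(\vec{x}_m,c)\wedge c\leq a)\rightarrow\phi_{(m+1)n}(\vec{x}_m,a,y)\big)\wedge\forall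 c\big((C_m(\vec{x}_m,a)\wedge C_m(\vec{x}_m,b)\wedge M(a,b,c))\rightarrow\phi_{(m+1)n}(\vec{x}_m,c,y)\big)\wedge\big(\exists c(C_m(\vec{x}_m,c)\wedge J(a,b,c))\rightarrow(\phi_{(m+1)n}(\vec{x}_m,a,y)\vee\phi_{(m+1)n}(\vec{x}_m,b,y))\big)\Big)$. -}

module Defs where

open import Level using (Level; _⊔_; Lift)
open import Data.Nat using (ℕ; zero; suc; _+_)
open import Data.Fin using (Fin; toℕ)
open import Data.Vec using (Vec; []; _∷_; _∷ʳ_; map; lookup; tabulate)
open import Data.Product using (_×_; ∃)
open import Data.Sum using (_⊎_)
open import Data.Empty using (⊥)
open import Relation.Nullary using (¬_)
open import Relation.Binary.Bundles using (Poset)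

-- First-order formulas in the signature {≤} (with equality),
-- variables as de Bruijn indices; ∀'/∃' bind index 0.

data Formula : Set where
  _≤'_ : ℕ → ℕ → Formula
  _≐_  : ℕ → ℕ → Formula
  ⊥'   : Formula
  ¬'_  : Formula → Formula
  _∧'_ : Formula → Formula → Formula
  _∨'_ : Formula → Formula → Formula
  _⇒'_ : Formula → Formula → Formula
  ∀'   : Formula → Formula
  ∃'   : Formula → Formula

infix  7 _≤'_ _≐_
infixr 6 _∧'_
infixr 5 _∨'_
infixr 4 _⇒'_

J : ℕ → ℕ → ℕ → Formula
J x y z = (x ≤' z) ∧' (y ≤' z) ∧' ∀' (((suc x ≤' 0) ∧' (suc y ≤' 0)) ⇒' (suc z ≤' 0))

M : ℕ → ℕ → ℕ → Formula
M x y z = (z ≤' x) ∧' (z ≤' y) ∧' ∀' (((0 ≤' suc x) ∧' (0 ≤' suc y)) ⇒' (0 ≤' suc z))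

C : ∀ {m} → Vec ℕ m → ℕ → Formula
C []       y = ⊥'
C (x ∷ xs) y = (y ≐ x) ∨' C xs y

D : ∀ {m} → Vec ℕ m → ℕ → Formula
D xs y = ¬' C xs y

phi : (m n : ℕ) → Vec ℕ m → ℕ → Formula
phi m zero    xs y = D xs y
phi m (suc n) xs y = ∀' (∀' (c1 ∧' c2 ∧' c3))
  where
  -- under ∀a∀b : b = 0, a = 1
  xs2 = map (2 +_) xs
  y2  = 2 + y
  -- under one more binder c : c = 0, b = 1, a = 2
  xs3 = map (3 +_) xs
  y3  = 3 + y
  c1 = ∃' (C xs3 0 ∧' (0 ≤' 2)) ⇒' phi (suc m) n (xs2 ∷ʳ 1) y2
  c2 = ∀' ((C xs3 2 ∧' C xs3 1 ∧' M 2 1 0) ⇒' phi (suc m) n (xs3 ∷ʳ 0) y3)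
  c3 = ∃' (C xs3 0 ∧' J 2 1 0) ⇒' (phi (suc m) n (xs2 ∷ʳ 1) y2 ∨' phi (suc m) n (xs2 ∷ʳ 0) y2)

xvars : (m : ℕ) → Vec ℕ m
xvars m = tabulate (λ i → suc (toℕ i))

yvar : ℕ
yvar = 0

module _ {c ℓ₁ ℓ₂ : Level} (P : Poset c ℓ₁ ℓ₂) where
  open Poset P

  _∷ₑ_ : Carrier → (ℕ → Carrier) → (ℕ → Carrier)
  (p ∷ₑ v) zero    = p
  (p ∷ₑ v) (suc i) = v i

  Sat : (ℕ → Carrier) → Formula → Set (c ⊔ ℓ₁ ⊔ ℓ₂)
  Sat v (i ≤' j) = Lift (c ⊔ ℓ₁) (v i ≤ v j)
  Sat v (i ≐ j)  = Lift (c ⊔ ℓ₂) (v i ≈ v j)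
  Sat v ⊥'       = Lift (c ⊔ ℓ₁ ⊔ ℓ₂) ⊥
  Sat v (¬' φ)   = ¬ Sat v φ
  Sat v (φ ∧' ψ) = Sat v φ × Sat v ψ
  Sat v (φ ∨' ψ) = Sat v φ ⊎ Sat v ψ
  Sat v (φ ⇒' ψ) = Sat v φ → Sat v ψ
  Sat v (∀' φ)   = (p : Carrier) → Sat (p ∷ₑ v) φ
  Sat v (∃' φ)   = ∃ λ (p : Carrier) → Sat (p ∷ₑ v) φ

  Subset : Set (c ⊔ Level.suc ℓ₁)
  Subset = Carrier → Set ℓ₁

  add : Subset → Carrier → Subset
  add U b p = U p ⊎ (p ≈ b)

  Disjoint : Subset → Subset → Set (c ⊔ ℓ₁)
  Disjoint U V = (p : Carrier) → U p → V p → ⊥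

  IsJoin : Carrier → Carrier → Carrier → Set (c ⊔ ℓ₂)
  IsJoin a b z = a ≤ z × b ≤ z × ((w : Carrier) → a ≤ w → b ≤ w → z ≤ w)

  IsMeet : Carrier → Carrier → Carrier → Set (c ⊔ ℓ₂)
  IsMeet a b z = z ≤ a × z ≤ b × ((w : Carrier) → w ≤ a → w ≤ b → w ≤ z)

  -- ∃ has an n-strategy in the game with current position (U , V):
  -- ∀ does not win in the current round, and (if n > 0) after every
  -- move of ∀ (with ∃'s choice in move (3)) ∃ has an (n-1)-strategy.
  HasStrategy : ℕ → Subset → Subset → Set (c ⊔ ℓ₁ ⊔ ℓ₂)
  HasStrategy zero    U V = Lift ℓ₂ (Disjoint U V)
  HasStrategy (suc n) U V =
    Disjoint U V
    × ((a b : Carrier) → U a → a ≤ b → HasStrategy n (add U b) V)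
    × ((a b z : Carrier) → U a → U b → IsMeet a b z → HasStrategy n (add U z) V)
    × ((a b z : Carrier) → IsJoin a b z → U z →
         HasStrategy n (add U a) V ⊎ HasStrategy n (add U b) V)

  StartU : (ℕ → Carrier) → ∀ {m} → Vec ℕ m → Subset
  StartU v {m} xs p = ∃ λ (i : Fin m) → p ≈ v (lookup xs i)

  StartV : (ℕ → Carrier) → ℕ → Subset
  StartV v y p = p ≈ v y

-- Strategies survive shrinking U (antitonicity), so they
--     depend on U only up to extensional equality; and an (n+1)-strategy is
--     the same as answering every single move of ∀ with an n-strategy
--     (the "no win now" condition is implied, because ∀ may re-add a member
--     of U).  The latter is phrased pointwise in the two elements a, b that
--     φ quantifies over (the predicate  Round).
--   * Positions as variable vectors.
-- The inductive step then matches the three conjuncts of φ_{m(n+1)} with the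
-- three kinds of moves, and the theorem is the case x⃗ = xvars m, y = yvar.
module Submission where

open import Defs
open import Level using (Level; _⊔_; Lift; lift; lower)
open import Data.Nat using (ℕ; zero; suc; _+_)
open import Data.Fin using (zero; suc)
open import Data.Vec using (Vec; []; _∷_; _∷ʳ_; map)
open import Data.Product using (_×_; _,_; ∃; proj₁; proj₂)
open import Data.Product.Function.NonDependent.Propositional using (_×-⇔_)
open import Data.Product.Function.Dependent.Propositional using () renaming (congˡ to ∃-cong)
open import Data.Sum using (_⊎_; inj₁; inj₂) renaming (map to ⊎-map)
open import Data.Sum.Function.Propositional using (_⊎-⇔_)
open import Relation.Nullary using (¬_)
open import Relation.Binary.Bundles using (Poset)
open import Relation.Binary.Definitions using (_Respects_)
open import Function.Bundles using (_⇔_; mk⇔; Equivalence)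
open import Function.Related.Propositional using (equivalence)
open import Function.Related.TypeIsomorphisms using (→-cong-⇔; ¬-cong-⇔)
import Function.Properties.Equivalence as ⇔

∀-cong : ∀ {a b c} {A : Set a} {B : A → Set b} {C : A → Set c} →
         ((x : A) → B x ⇔ C x) → ((x : A) → B x) ⇔ ((x : A) → C x)
∀-cong B⇔C = mk⇔ (λ f x → Equivalence.to (B⇔C x) (f x)) (λ g x → Equivalence.from (B⇔C x) (g x))

Lift-⇔ : ∀ {a} ℓ {A : Set a} → Lift ℓ A ⇔ A
Lift-⇔ ℓ = mk⇔ lower lift

module _ {c ℓ₁ ℓ₂ : Level} (P : Poset c ℓ₁ ℓ₂) where
  open Poset P

  Valuation : Set c
  Valuation = ℕ → Carrier

  infixr 5 _∷ᵥ_
  _∷ᵥ_ : Carrier → Valuation → Valuation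
  _∷ᵥ_ = _∷ₑ_ P

  infix 4 _⊆_ _≅_
  _⊆_ : Subset P → Subset P → Set (c ⊔ ℓ₁)
  U ⊆ U′ = ∀ p → U p → U′ p

  _≅_ : Subset P → Subset P → Set (c ⊔ ℓ₁)
  U ≅ U′ = U ⊆ U′ × U′ ⊆ U

  add-mono : ∀ {U U′} b → U ⊆ U′ → add P U b ⊆ add P U′ b
  add-mono b U⊆U′ p (inj₁ u) = inj₁ (U⊆U′ p u)
  add-mono b U⊆U′ p (inj₂ e) = inj₂ e

  -- A strategy from a position also works from any position with fewer
  -- elements in U: every move of ∀ there is available from the larger one.
  strategy-antitone : ∀ n {U U′ V} → U′ ⊆ U → HasStrategy P n U V → HasStrategy P n U′ V
  strategy-antitone zero    U′⊆U (lift disj) = lift (λ p u′ → disj p (U′⊆U p u′))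
  strategy-antitone (suc n) {U} {U′} {V} U′⊆U (disj , up , meet , join) =
      (λ p u′ → disj p (U′⊆U p u′))
    , (λ a b ua a≤b → shrink b (up a b (U′⊆U a ua) a≤b))
    , (λ a b z ua ub a∧b → shrink z (meet a b z (U′⊆U a ua) (U′⊆U b ub) a∧b))
    , (λ a b z a∨b uz → ⊎-map (shrink a) (shrink b) (join a b z a∨b (U′⊆U z uz)))
    where
    shrink : ∀ p → HasStrategy P n (add P U p) V → HasStrategy P n (add P U′ p) V
    shrink p = strategy-antitone n (add-mono p U′⊆U)

  strategy-cong : ∀ n {U U′ V} → U ≅ U′ → HasStrategy P n U V ⇔ HasStrategy P n U′ V
  strategy-cong n (U⊆U′ , U′⊆U) = mk⇔ (strategy-antitone n U′⊆U) (strategy-antitone n U⊆U′)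

  strategy-disjoint : ∀ n {U V} → HasStrategy P n U V → Disjoint P U V
  strategy-disjoint zero    (lift disj) = disj
  strategy-disjoint (suc n) (disj , _)  = disj

  -- ∃'s obligations in the next round for a pair (a , b) of elements of P,
  -- in the shape of the three conjuncts of φ: move (1) adding a, move (2)
  -- with a ∧ b, move (3) with a ∨ b.
  Round : ℕ → Subset P → Subset P → Carrier → Carrier → Set (c ⊔ ℓ₁ ⊔ ℓ₂)
  Round n U V a b =
      ((∃ λ x → U x × x ≤ a) → HasStrategy P n (add P U a) V)
    × ((z : Carrier) → U a × U b × IsMeet P a b z → HasStrategy P n (add P U z) V)
    × ((∃ λ z → U z × IsJoin P a b z) → HasStrategy P n (add P U a) V ⊎ HasStrategy P n (add P U b) V)

  -- U ∩ V = ∅ need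
  -- not be required separately: ∀ may play move (1) with b = a ∈ U, after
  -- which ∃ needs U ∪ {a} = U to be disjoint from V.
  strategy-suc : ∀ n {U V} → HasStrategy P (suc n) U V ⇔ (∀ a b → Round n U V a b)
  strategy-suc n {U} {V} = mk⇔ to from
    where
    to : HasStrategy P (suc n) U V → ∀ a b → Round n U V a b
    to (_ , up , meet , join) a b =
        (λ (x , ux , x≤a) → up x a ux x≤a)
      , (λ z (ua , ub , a∧b) → meet a b z ua ub a∧b)
      , (λ (z , uz , a∨b) → join a b z a∨b uz)

    from : (∀ a b → Round n U V a b) → HasStrategy P (suc n) U V
    from round =
        (λ p up → strategy-disjoint n (proj₁ (round p p) (p , up , refl)) p (inj₂ Eq.refl))
      , (λ a b ua a≤b → proj₁ (round b b) (a , ua , a≤b))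
      , (λ a b z ua ub a∧b → proj₁ (proj₂ (round a b)) z (ua , ub , a∧b))
      , (λ a b z a∨b uz → proj₂ (proj₂ (round a b)) (z , uz , a∨b))

  disjoint-point : ∀ {U q} → U Respects _≈_ → (¬ U q) ⇔ Disjoint P U (λ p → p ≈ q)
  disjoint-point {U} {q} resp = mk⇔
    (λ q∉U p up p≈q → q∉U (resp p≈q up))
    (λ disj uq → disj q uq Eq.refl)

  startU-resp : ∀ (w : Valuation) {m} (xs : Vec ℕ m) → StartU P w xs Respects _≈_
  startU-resp w xs p≈q (i , p≈xᵢ) = i , Eq.trans (Eq.sym p≈q) p≈xᵢ

  startU-map : ∀ (w : Valuation) (f : ℕ → ℕ) {m} (xs : Vec ℕ m) →
               StartU P w (map f xs) ≅ StartU P (λ k → w (f k)) xs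
  startU-map w f xs = to xs , from xs
    where
    to : ∀ {m} (xs : Vec ℕ m) → StartU P w (map f xs) ⊆ StartU P (λ k → w (f k)) xs
    to (x ∷ xs) p (zero  , e) = zero , e
    to (x ∷ xs) p (suc i , e) with to xs p (i , e)
    ... | j , e′ = suc j , e′

    from : ∀ {m} (xs : Vec ℕ m) → StartU P (λ k → w (f k)) xs ⊆ StartU P w (map f xs)
    from (x ∷ xs) p (zero  , e) = zero , e
    from (x ∷ xs) p (suc i , e) with from xs p (i , e)
    ... | j , e′ = suc j , e′

  startU-snoc : ∀ (w : Valuation) {m} (xs : Vec ℕ m) x →
                StartU P w (xs ∷ʳ x) ≅ add P (StartU P w xs) (w x)
  startU-snoc w xs x = to xs , from xs
    where
    to : ∀ {m} (xs : Vec ℕ m) → StartU P w (xs ∷ʳ x) ⊆ add P (StartU P w xs) (w x)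
    to []       p (zero  , e) = inj₂ e
    to (y ∷ ys) p (zero  , e) = inj₁ (zero , e)
    to (y ∷ ys) p (suc i , e) with to ys p (i , e)
    ... | inj₁ (j , e′) = inj₁ (suc j , e′)
    ... | inj₂ e′       = inj₂ e′

    from : ∀ {m} (xs : Vec ℕ m) → add P (StartU P w xs) (w x) ⊆ StartU P w (xs ∷ʳ x)
    from []       p (inj₂ e)           = zero , e
    from (y ∷ ys) p (inj₁ (zero  , e)) = zero , e
    from (y ∷ ys) p (inj₁ (suc i , e)) with from ys p (inj₁ (i , e))
    ... | j , e′ = suc j , e′
    from (y ∷ ys) p (inj₂ e) with from ys p (inj₂ e)
    ... | j , e′ = suc j , e′

  startU-extend : ∀ (w : Valuation) (f : ℕ → ℕ) {m} (xs : Vec ℕ m) x →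
                  StartU P w (map f xs ∷ʳ x) ≅ add P (StartU P (λ k → w (f k)) xs) (w x)
  startU-extend w f xs x =
    let (snoc→ , snoc←) = startU-snoc w (map f xs) x
        (map→ , map←)   = startU-map w f xs
    in  (λ p h → add-mono (w x) map→ p (snoc→ p h))
      , (λ p h → snoc← p (add-mono (w x) map← p h))

  sat-C : ∀ (w : Valuation) {m} (xs : Vec ℕ m) j → Sat P w (C xs j) ⇔ StartU P w xs (w j)
  sat-C w xs j = mk⇔ (to xs) (from xs)
    where
    to : ∀ {m} (xs : Vec ℕ m) → Sat P w (C xs j) → StartU P w xs (w j)
    to (x ∷ xs) (inj₁ (lift e)) = zero , e
    to (x ∷ xs) (inj₂ s) with to xs s
    ... | i , e = suc i , e

    from : ∀ {m} (xs : Vec ℕ m) → StartU P w xs (w j) → Sat P w (C xs j)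
    from (x ∷ xs) (zero  , e) = inj₁ (lift e)
    from (x ∷ xs) (suc i , e) = inj₂ (from xs (i , e))

  sat-C-map : ∀ (w : Valuation) (f : ℕ → ℕ) {m} (xs : Vec ℕ m) j →
              Sat P w (C (map f xs) j) ⇔ StartU P (λ k → w (f k)) xs (w j)
  sat-C-map w f xs j = ⇔.trans (sat-C w (map f xs) j)
    (mk⇔ (proj₁ (startU-map w f xs) (w j)) (proj₂ (startU-map w f xs) (w j)))

  sat-M : ∀ (w : Valuation) i j k → Sat P w (M i j k) ⇔ IsMeet P (w i) (w j) (w k)
  sat-M w i j k = mk⇔
    (λ (lift k≤i , lift k≤j , glb) → k≤i , k≤j , λ p p≤i p≤j → lower (glb p (lift p≤i , lift p≤j)))
    (λ (k≤i , k≤j , glb) → lift k≤i , lift k≤j , λ p (lift p≤i , lift p≤j) → lift (glb p p≤i p≤j))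

  sat-J : ∀ (w : Valuation) i j k → Sat P w (J i j k) ⇔ IsJoin P (w i) (w j) (w k)
  sat-J w i j k = mk⇔
    (λ (lift i≤k , lift j≤k , lub) → i≤k , j≤k , λ p i≤p j≤p → lower (lub p (lift i≤p , lift j≤p)))
    (λ (i≤k , j≤k , lub) → lift i≤k , lift j≤k , λ p (lift i≤p , lift j≤p) → lift (lub p i≤p j≤p))

  phi-strategy : ∀ n m (xs : Vec ℕ m) y (v : Valuation) →
                 Sat P v (phi m n xs y) ⇔ HasStrategy P n (StartU P v xs) (StartV P v y)
  phi-strategy zero m xs y v =
    ⇔.trans (¬-cong-⇔ (sat-C v xs y))
      (⇔.trans (disjoint-point (startU-resp v xs)) (⇔.sym (Lift-⇔ ℓ₂)))
  phi-strategy (suc n) m xs y v =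
    ⇔.trans rounds (⇔.sym (strategy-suc n))
    where
    U V : Subset P
    U = StartU P v xs
    V = StartV P v y

    -- The induction hypothesis for x⃗ extended by the variable j, read under
    -- k new binders: w (k + i) is the outer value v i, so the position is U ∪ {w j}.
    extended : ∀ k (w : Valuation) j →
               Sat P w (phi (suc m) n (map (k +_) xs ∷ʳ j) (k + y))
               ⇔ HasStrategy P n (add P (StartU P (λ i → w (k + i)) xs) (w j)) (StartV P (λ i → w (k + i)) y)
    extended k w j = ⇔.trans (phi-strategy n (suc m) _ (k + y) w)
                             (strategy-cong n (startU-extend w (k +_) xs j))

    -- The three conjuncts of φ_{m(n+1)} at (a , b) are the obligations of
    -- Round for moves (1), (2) and (3); variables 0, 1, 2 denote c (or z), b, a.
    rounds : Sat P v (phi m (suc n) xs y) ⇔ (∀ a b → Round n U V a b)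
    rounds = ∀-cong λ a → ∀-cong λ b →
          →-cong-⇔ (∃-cong {k = equivalence} λ {x} →
                      sat-C-map (x ∷ᵥ b ∷ᵥ a ∷ᵥ v) (3 +_) xs 0 ×-⇔ Lift-⇔ (c ⊔ ℓ₁))
                   (extended 2 (b ∷ᵥ a ∷ᵥ v) 1)
      ×-⇔ ∀-cong (λ z → let w = z ∷ᵥ b ∷ᵥ a ∷ᵥ v in
            →-cong-⇔ (sat-C-map w (3 +_) xs 2 ×-⇔ sat-C-map w (3 +_) xs 1 ×-⇔ sat-M w 2 1 0)
                     (extended 3 w 0))
      ×-⇔ →-cong-⇔ (∃-cong {k = equivalence} λ {z} →
                      sat-C-map (z ∷ᵥ b ∷ᵥ a ∷ᵥ v) (3 +_) xs 0 ×-⇔ sat-J (z ∷ᵥ b ∷ᵥ a ∷ᵥ v) 2 1 0)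
                   (extended 2 (b ∷ᵥ a ∷ᵥ v) 1 ⊎-⇔ extended 2 (b ∷ᵥ a ∷ᵥ v) 0)

lemma4p1 : ∀ {c ℓ₁ ℓ₂ : Level} (P : Poset c ℓ₁ ℓ₂) (v : ℕ → Poset.Carrier P) (m n : ℕ) →
    Sat P v (phi m n (xvars m) yvar) ⇔ HasStrategy P n (StartU P v (xvars m)) (StartV P v yvar)
lemma4p1 P v m n = phi-strategy P n m (xvars m) yvar v
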